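{- Let $G=(V,E)$ be a simple graph on $n$ vertices and $C\subseteq V$ such that no vertex of $V\setminus C$ is isolated in $G$. Let $t$ be a positive integer with $t\le\gamma_{\rm gr}(G;C)$, and let $\delta_t$ be the minimum of $\bigl|\bigcup_{i=1}^t N\langle v_i\rangle\bigr|$ over all legal sequences $(v_1,\ldots,v_t)$ of $G;C$. Then $\gamma_{\rm gr}(G;C)\le n-\delta_t+t$.
   Context: For $v\in V$, $N(v)$ is the open neighborhood and $N[v]=N(v)\cup\{v\}$. Define $N\langle v\rangle=N[v]$ if $v\in C$ and $N\langle v\rangle=N(v)$ if $v\notin C$. A sequence $(v_1,\ldots,v_k)$ of distinct vertices is a legal sequence of $G;C$ if $N\langle v_i\rangle\setminus\bigcup_{j=1}^{i-1}N\langle v_j\rangle\neq\emptyset$ for all $i=2,\ldots,k$; it is dominating if $\bigcup_{j=1}^k N\langle v_j\rangle=V$. $\gamma_{\rm gr}(G;C)$ is the maximum length of a legal dominating sequence of $G;C$. -}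

module Defs where

open import Data.Nat using (ℕ; _≤_)
open import Data.Bool using (Bool; true; false; _∨_; _∧_; not; if_then_else_)
open import Data.Fin using (Fin; _≟_)
open import Data.List using (List; []; _∷_; length; filter)
open import Data.Bool.ListAction using (any)
open import Data.Bool.Properties using () renaming (_≟_ to _≟b_)
open import Data.Unit using (⊤)
open import Data.List.Relation.Unary.Unique.Propositional using (Unique)
open import Data.Product using (Σ; _×_; ∃)
open import Data.Empty using (⊥)
open import Relation.Binary.PropositionalEquality using (_≡_)
open import Relation.Nullary.Decidable using (⌊_⌋)
open import Relation.Nullary using (¬_)
open import Data.Fin.Base using ()
open import Data.List.Base using (allFin)

record SimpleGraph (n : ℕ) : Set where
  field
    adj   : Fin n → Fin n → Bool
    sym   : ∀ u v → adj u v ≡ adj v u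
    irrefl : ∀ v → adj v v ≡ false
open SimpleGraph public

VSubset : ℕ → Set
VSubset n = Fin n → Bool

-- u ∈ N⟨v⟩ : u ∈ N[v] if v ∈ C, u ∈ N(v) otherwise.
inN⟨⟩ : ∀ {n} → SimpleGraph n → VSubset n → Fin n → Fin n → Bool
inN⟨⟩ G C v u = adj G v u ∨ (C v ∧ ⌊ u ≟ v ⌋)

inUnion : ∀ {n} → SimpleGraph n → VSubset n → List (Fin n) → Fin n → Bool
inUnion G C ws u = any (λ w → inN⟨⟩ G C w u) ws

unionSize : ∀ {n} → SimpleGraph n → VSubset n → List (Fin n) → ℕ
unionSize {n} G C ws = length (filter (λ u → inUnion G C ws u ≟b true) (allFin n))

-- Legality, with the sequence stored in order v₁ ∷ v₂ ∷ … ; `prev` are earlier vertices.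
-- Each vertex after the first footprints some vertex not in the union of earlier ones.
LegalFrom : ∀ {n} → SimpleGraph n → VSubset n → List (Fin n) → List (Fin n) → Set
LegalFrom G C prev [] = ⊤
LegalFrom G C prev (v ∷ vs) =
  (∃ λ u → inN⟨⟩ G C v u ≡ true × inUnion G C prev u ≡ false)
  × LegalFrom G C (v ∷ prev) vs

Legal : ∀ {n} → SimpleGraph n → VSubset n → List (Fin n) → Set
Legal G C [] = ⊤
Legal G C (v ∷ vs) = Unique (v ∷ vs) × LegalFrom G C (v ∷ []) vs

Dominating : ∀ {n} → SimpleGraph n → VSubset n → List (Fin n) → Set
Dominating G C ws = ∀ u → inUnion G C ws u ≡ true

IsGrundyDomNumber : ∀ {n} → SimpleGraph n → VSubset n → ℕ → Set
IsGrundyDomNumber G C g =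
  (∃ λ ws → Legal G C ws × Dominating G C ws × length ws ≡ g)
  × (∀ ws → Legal G C ws → Dominating G C ws → length ws ≤ g)

IsDeltaT : ∀ {n} → SimpleGraph n → VSubset n → ℕ → ℕ → Set
IsDeltaT G C t d =
  (∃ λ ws → Legal G C ws × length ws ≡ t × unionSize G C ws ≡ d)
  × (∀ ws → Legal G C ws → length ws ≡ t → d ≤ unionSize G C ws)

NoIsolatedOutsideC : ∀ {n} → SimpleGraph n → VSubset n → Set
NoIsolatedOutsideC {n} G C = ∀ v → C v ≡ false → ∃ λ u → adj G v u ≡ true

-- Let (v₁,…,v_g) be a legal dominating sequence of maximum length g and split it
-- after its first t vertices.  The prefix is a legal sequence of length t, so its
-- footprint ⋃ N⟨vᵢ⟩ has at least δ_t vertices, and each of the remaining g − t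
-- vertices footprints a vertex not yet covered.  Hence δ_t + (g − t) ≤ n.
-- No vertex outside C being isolated only guarantees that γ_gr(G;C) exists, which
-- IsGrundyDomNumber already provides.
module Submission where

open import Defs hiding (sym)
open import Data.Nat using (ℕ; suc; z≤n; s≤s; _≤_; _<_; _+_; _∸_)
open import Data.Nat.Properties
  using ( ≤-refl; ≤-trans; ≤-reflexive; +-suc; +-comm; +-monoʳ-≤; +-monoˡ-≤
        ; m≤n⇒m≤1+n; m+n≤o⇒m≤o∸n; module ≤-Reasoning)
open import Data.Bool using (Bool; true; false; _∨_)
open import Data.Bool.Properties
  using (∨-assoc; ∨-comm; ∨-identityʳ; ∨-zeroʳ) renaming (_≟_ to _≟b_)
open import Data.Bool.ListAction using (any)
open import Data.List using (List; []; _∷_; [_]; length; filter; _++_; _ʳ++_; reverse; allFin)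
open import Data.List.Properties using (length-filter; length-tabulate; length-++; ++-ʳ++)
open import Data.List.Membership.Propositional using (_∈_)
open import Data.List.Membership.Propositional.Properties using (∈-allFin)
open import Data.List.Relation.Unary.Any using (here; there)
open import Data.List.Relation.Unary.AllPairs using ([]; _∷_)
open import Data.List.Relation.Unary.All.Properties using (++⁻ˡ)
open import Data.List.Relation.Unary.Unique.Propositional using (Unique)
open import Data.Product using (∃₂; _×_; _,_; proj₁; proj₂)
open import Relation.Binary.PropositionalEquality
  using (_≡_; refl; sym; trans; cong; module ≡-Reasoning)

count : ∀ {A : Set} → (A → Bool) → List A → ℕ
count p xs = length (filter (λ x → p x ≟b true) xs)

module _ {A : Set} {p q : A → Bool} where

  count-cong : (∀ x → p x ≡ q x) → ∀ xs → count p xs ≡ count q xs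
  count-cong p≗q [] = refl
  count-cong p≗q (x ∷ xs) rewrite p≗q x with q x
  ... | true  = cong suc (count-cong p≗q xs)
  ... | false = count-cong p≗q xs

  count-mono : (∀ {x} → p x ≡ true → q x ≡ true) → ∀ xs → count p xs ≤ count q xs
  count-mono p⇒q [] = z≤n
  count-mono p⇒q (x ∷ xs) with p x in px | q x in qx
  ... | true  | true  = s≤s (count-mono p⇒q xs)
  ... | false | true  = m≤n⇒m≤1+n (count-mono p⇒q xs)
  ... | false | false = count-mono p⇒q xs
  ... | true  | false with () ← trans (sym (p⇒q px)) qx

  count-< : (∀ {x} → p x ≡ true → q x ≡ true) →
            ∀ {y xs} → y ∈ xs → p y ≡ false → q y ≡ true → count p xs < count q xs
  count-< p⇒q {xs = x ∷ xs} (here refl) py qy rewrite py | qy = s≤s (count-mono p⇒q xs)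
  count-< p⇒q {xs = x ∷ xs} (there y∈xs) py qy with p x in px | q x in qx
  ... | true  | true  = s≤s (count-< p⇒q y∈xs py qy)
  ... | false | true  = m≤n⇒m≤1+n (count-< p⇒q y∈xs py qy)
  ... | false | false = count-< p⇒q y∈xs py qy
  ... | true  | false with () ← trans (sym (p⇒q px)) qx

any-ʳ++ : ∀ {A : Set} (p : A → Bool) xs ys → any p (xs ʳ++ ys) ≡ any p xs ∨ any p ys
any-ʳ++ p [] ys = refl
any-ʳ++ p (x ∷ xs) ys = begin
  any p (xs ʳ++ x ∷ ys)         ≡⟨ any-ʳ++ p xs (x ∷ ys) ⟩
  any p xs ∨ (p x ∨ any p ys)   ≡⟨ ∨-assoc (any p xs) (p x) (any p ys) ⟨
  (any p xs ∨ p x) ∨ any p ys   ≡⟨ cong (_∨ any p ys) (∨-comm (any p xs) (p x)) ⟩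
  (p x ∨ any p xs) ∨ any p ys   ∎
  where open ≡-Reasoning

any-reverse : ∀ {A : Set} (p : A → Bool) xs → any p (reverse xs) ≡ any p xs
any-reverse p xs = trans (any-ʳ++ p xs []) (∨-identityʳ (any p xs))

Unique-++⁻ˡ : ∀ {A : Set} (xs {ys} : List A) → Unique (xs ++ ys) → Unique xs
Unique-++⁻ˡ []       _         = []
Unique-++⁻ˡ (x ∷ xs) (x∉ ∷ u) = ++⁻ˡ xs x∉ ∷ Unique-++⁻ˡ xs u

splitAt-length : ∀ {A : Set} t (ws : List A) → t ≤ length ws →
                 ∃₂ λ xs ys → ws ≡ xs ++ ys × length xs ≡ t
splitAt-length 0       ws       _         = [] , ws , refl , refl
splitAt-length (suc t) (w ∷ ws) (s≤s t≤∣ws∣) with splitAt-length t ws t≤∣ws∣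
... | xs , ys , refl , refl = w ∷ xs , ys , refl , refl

module _ {n : ℕ} (G : SimpleGraph n) (C : VSubset n) where

  unionSize≤n : ∀ ws → unionSize G C ws ≤ n
  unionSize≤n ws = ≤-trans (length-filter _ (allFin n)) (≤-reflexive (length-tabulate _))

  unionSize-reverse : ∀ ws → unionSize G C (reverse ws) ≡ unionSize G C ws
  unionSize-reverse ws = count-cong (λ u → any-reverse (λ w → inN⟨⟩ G C w u) ws) (allFin n)

  LegalFrom-++⁻ : ∀ prev xs {ys} → LegalFrom G C prev (xs ++ ys) →
                  LegalFrom G C prev xs × LegalFrom G C (xs ʳ++ prev) ys
  LegalFrom-++⁻ prev []       legal          = _ , legal
  LegalFrom-++⁻ prev (x ∷ xs) (fresh , rest) =
    let xs-legal , ys-legal = LegalFrom-++⁻ (x ∷ prev) xs rest in (fresh , xs-legal) , ys-legal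

  Legal-++⁻ˡ : ∀ xs {ys} → Legal G C (xs ++ ys) → Legal G C xs
  Legal-++⁻ˡ []       _             = _
  Legal-++⁻ˡ (x ∷ xs) (unique , legal) =
    Unique-++⁻ˡ (x ∷ xs) unique , proj₁ (LegalFrom-++⁻ [ x ] xs legal)

  unionSize-LegalFrom : ∀ prev vs → LegalFrom G C prev vs →
                        length vs + unionSize G C prev ≤ unionSize G C (vs ʳ++ prev)
  unionSize-LegalFrom prev []       _ = ≤-refl
  unionSize-LegalFrom prev (v ∷ vs) ((u , u∈N⟨v⟩ , u∉prev) , legal) = begin
    suc (length vs) + unionSize G C prev     ≡⟨ +-suc (length vs) _ ⟨
    length vs + suc (unionSize G C prev)     ≤⟨ +-monoʳ-≤ (length vs) fresh-vertex ⟩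
    length vs + unionSize G C (v ∷ prev)     ≤⟨ unionSize-LegalFrom (v ∷ prev) vs legal ⟩
    unionSize G C (vs ʳ++ v ∷ prev)          ∎
    where
    open ≤-Reasoning
    fresh-vertex : unionSize G C prev < unionSize G C (v ∷ prev)
    fresh-vertex = count-< (λ {w} e → trans (cong (inN⟨⟩ G C v w ∨_) e) (∨-zeroʳ _))
                           (∈-allFin u) u∉prev (cong (_∨ inUnion G C prev u) u∈N⟨v⟩)

  unionSize-Legal-++ : ∀ v xs ys → Legal G C (v ∷ xs ++ ys) →
                       length ys + unionSize G C (v ∷ xs) ≤ unionSize G C (v ∷ xs ++ ys)
  unionSize-Legal-++ v xs ys (_ , legal) = begin
    length ys + unionSize G C (v ∷ xs)        ≡⟨ cong (length ys +_) (unionSize-reverse (v ∷ xs)) ⟨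
    length ys + unionSize G C (xs ʳ++ [ v ])  ≤⟨ unionSize-LegalFrom (xs ʳ++ [ v ]) ys ys-legal ⟩
    unionSize G C (ys ʳ++ xs ʳ++ [ v ])       ≡⟨ cong (unionSize G C) (++-ʳ++ xs) ⟨
    unionSize G C (reverse (v ∷ xs ++ ys))    ≡⟨ unionSize-reverse (v ∷ xs ++ ys) ⟩
    unionSize G C (v ∷ xs ++ ys)              ∎
    where
    open ≤-Reasoning
    ys-legal : LegalFrom G C (xs ʳ++ [ v ]) ys
    ys-legal = proj₂ (LegalFrom-++⁻ [ v ] xs legal)

corollary1 : ∀ (n : ℕ) (G : SimpleGraph n) (C : VSubset n) →
    NoIsolatedOutsideC G C →
    ∀ (t g d : ℕ) → 1 ≤ t → IsGrundyDomNumber G C g → t ≤ g →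
    IsDeltaT G C t d → g ≤ n ∸ d + t
corollary1 n G C _ (suc t) g d (s≤s z≤n) ((ws , legal , _ , refl) , _) t≤g (_ , δ-minimal)
  with splitAt-length (suc t) ws t≤g
... | v ∷ xs , ys , refl , refl = begin
  length (v ∷ xs ++ ys)        ≡⟨ length-++ (v ∷ xs) ⟩
  suc (length xs) + length ys  ≡⟨ +-comm (suc (length xs)) (length ys) ⟩
  length ys + suc (length xs)  ≤⟨ +-monoˡ-≤ (suc (length xs)) (m+n≤o⇒m≤o∸n (length ys) suffix+δ≤n) ⟩
  n ∸ d + suc (length xs)      ∎
  where
  open ≤-Reasoning
  δ≤prefix : d ≤ unionSize G C (v ∷ xs)
  δ≤prefix = δ-minimal (v ∷ xs) (Legal-++⁻ˡ G C (v ∷ xs) legal) refl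
  suffix+δ≤n : length ys + d ≤ n
  suffix+δ≤n = begin
    length ys + d                       ≤⟨ +-monoʳ-≤ (length ys) δ≤prefix ⟩
    length ys + unionSize G C (v ∷ xs)  ≤⟨ unionSize-Legal-++ G C v xs ys legal ⟩
    unionSize G C (v ∷ xs ++ ys)        ≤⟨ unionSize≤n G C (v ∷ xs ++ ys) ⟩
    n                                   ∎
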